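{- Let $h:\mathbf F_{\mathsf V}(z)\to\prod_{k=1}^m\mathbf E_k$ be an algebraic e-generalization problem for a variety $\mathsf V$ and let $\theta\in\mathscr G(h)$. Then the natural epimorphism $n_\theta:\mathbf F_{\mathsf V}(z)\to\mathbf F_{\mathsf V}(z)/\theta$ is a solution of $h$ if and only if $\theta$ is projective. Moreover, in that case $n_\theta$ is the top element of $\Pi_\theta(h)$ with respect to $\sqsubseteq$, i.e. $g\sqsubseteq n_\theta$ for every $g\in\Pi_\theta(h)$.
   Context: $\mathbf F_{\mathsf V}(z)$ is the 1-generated free algebra of $\mathsf V$. Projective = retract of a free algebra; exact = isomorphic to a finitely generated subalgebra of a finitely generated free algebra; a congruence $\theta$ of $\mathbf F_{\mathsf V}(z)$ is projective if $\mathbf F_{\mathsf V}(z)/\theta$ is projective. An algebraic e-generalization problem is a homomorphism $h:\mathbf F_{\mathsf V}(z)\to\prod_{k=1}^m\mathbf E_k$ ($m\ge1$), each $\mathbf E_k$ 1-generated exact, each $p_k\circ h$ surjective. A solution is a homomorphism $g:\mathbf F_{\mathsf V}(z)\to\mathbf P$, $\mathbf P$ finitely generated projective, with $f\circ g=h$ for some homomorphism $f$. $g\sqsubseteq g'$ iff $f\circ g'=g$ for some homomorphism $f$. $\mathscr G(h)=\{\ker(g):g\text{ a solution of }h\}$, and for $\theta\in\mathscr G(h)$, $\Pi_\theta(h)=\{g: g\text{ a solution of }h,\ \ker(g)=\theta\}$. -}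

module Defs where

open import Level using (0ℓ)
open import Data.Nat using (ℕ; _≥_)
open import Data.Fin using (Fin)
open import Data.Unit using (⊤)
open import Data.Product using (Σ; Σ-syntax; _×_; _,_; proj₁; proj₂)
open import Data.Vec using (Vec; []; _∷_; map)
open import Data.Vec.Properties using (map-id)
open import Data.Vec.Relation.Binary.Pointwise.Inductive as PW using (Pointwise; []; _∷_)
open import Relation.Binary.Structures using (IsEquivalence)
open import Relation.Binary.PropositionalEquality as P using (_≡_)
open import Function using (id)

record Signature : Set₁ where
  field
    Op    : Set
    arity : Op → ℕ

module _ (S : Signature) where
  open Signature S

  data Term (X : Set) : Set where
    var : X → Term X
    app : (f : Op) → Vec (Term X) (arity f) → Term X

  module _ {A : Set} (op : (f : Op) → Vec A (arity f) → A) {X : Set} (ρ : X → A) where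
    mutual
      evalI : Term X → A
      evalI (var x)    = ρ x
      evalI (app f ts) = op f (evalsI ts)

      evalsI : ∀ {n} → Vec (Term X) n → Vec A n
      evalsI []       = []
      evalsI (t ∷ ts) = evalI t ∷ evalsI ts

  subst : {X Y : Set} → (X → Term Y) → Term X → Term Y
  subst σ = evalI app σ

  record Algebra : Set₁ where
    field
      Carrier : Set
      _≈_     : Carrier → Carrier → Set
      isEquiv : IsEquivalence _≈_
      op      : (f : Op) → Vec Carrier (arity f) → Carrier
      op-cong : (f : Op) {xs ys : Vec Carrier (arity f)} →
                Pointwise _≈_ xs ys → op f xs ≈ op f ys

    eval : {X : Set} → (X → Carrier) → Term X → Carrier
    eval ρ t = evalI op ρ t

  open Algebra public

  record Hom (A B : Algebra) : Set where
    field
      fun      : Carrier A → Carrier B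
      cong     : ∀ {x y} → _≈_ A x y → _≈_ B (fun x) (fun y)
      preserve : (f : Op) (xs : Vec (Carrier A) (arity f)) →
                 _≈_ B (fun (op A f xs)) (op B f (map fun xs))

  open Hom public

  module _ {m : ℕ} (A : Fin m → Algebra) where
    private
      C : Set
      C = (k : Fin m) → Carrier (A k)
      _≈∏_ : C → C → Set
      x ≈∏ y = (k : Fin m) → _≈_ (A k) (x k) (y k)

      proj-pw : ∀ {n} {xs ys : Vec C n} (k : Fin m) → Pointwise _≈∏_ xs ys →
                Pointwise (_≈_ (A k)) (map (λ x → x k) xs) (map (λ x → x k) ys)
      proj-pw k []       = []
      proj-pw k (p ∷ ps) = p k ∷ proj-pw k ps

    Prod : Algebra
    Prod = record
      { Carrier = C
      ; _≈_     = _≈∏_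
      ; isEquiv = record
          { refl  = λ k → IsEquivalence.refl (isEquiv (A k))
          ; sym   = λ p k → IsEquivalence.sym (isEquiv (A k)) (p k)
          ; trans = λ p q k → IsEquivalence.trans (isEquiv (A k)) (p k) (q k)
          }
      ; op      = λ f xs k → op (A k) f (map (λ x → x k) xs)
      ; op-cong = λ f ps k → op-cong (A k) f (proj-pw k ps)
      }

    proj : (k : Fin m) → Hom Prod (A k)
    proj k = record
      { fun      = λ x → x k
      ; cong     = λ p → p k
      ; preserve = λ f xs → IsEquivalence.refl (isEquiv (A k))
      }

record Variety : Set₁ where
  field
    sig : Signature
    Eqn : Set
    lhs : Eqn → Term sig ℕ
    rhs : Eqn → Term sig ℕ

module _ (V : Variety) where
  open Variety V
  open Signature sig

  record VAlgebra : Set₁ where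
    field
      alg : Algebra sig
      sat : (e : Eqn) (ρ : ℕ → Carrier alg) →
            _≈_ alg (eval alg ρ (lhs e)) (eval alg ρ (rhs e))

  open VAlgebra public

  data _⊢_≈_ (X : Set) : Term sig X → Term sig X → Set where
    ⊢refl  : ∀ {t} → X ⊢ t ≈ t
    ⊢sym   : ∀ {t u} → X ⊢ t ≈ u → X ⊢ u ≈ t
    ⊢trans : ∀ {t u v} → X ⊢ t ≈ u → X ⊢ u ≈ v → X ⊢ t ≈ v
    ⊢app   : (f : Op) {ts us : Vec (Term sig X) (arity f)} →
             Pointwise (X ⊢_≈_) ts us → X ⊢ app f ts ≈ app f us
    ⊢ax    : (e : Eqn) (σ : ℕ → Term sig X) →
             X ⊢ subst sig σ (lhs e) ≈ subst sig σ (rhs e)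

  F : (X : Set) → VAlgebra
  F X = record
    { alg = record
        { Carrier = Term sig X
        ; _≈_     = X ⊢_≈_
        ; isEquiv = record { refl = ⊢refl ; sym = ⊢sym ; trans = ⊢trans }
        ; op      = app
        ; op-cong = ⊢app
        }
    ; sat = ⊢ax
    }

  record Congruence (A : VAlgebra) : Set₁ where
    field
      rel     : Carrier (alg A) → Carrier (alg A) → Set
      isEquiv : IsEquivalence rel
      ⊇≈      : ∀ {x y} → _≈_ (alg A) x y → rel x y
      compat  : (f : Op) {xs ys : Vec (Carrier (alg A)) (arity f)} →
                Pointwise rel xs ys → rel (op (alg A) f xs) (op (alg A) f ys)

  Quot : (A : VAlgebra) → Congruence A → VAlgebra
  Quot A θ = record
    { alg = record
        { Carrier = Carrier (alg A)
        ; _≈_     = Congruence.rel θ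
        ; isEquiv = Congruence.isEquiv θ
        ; op      = op (alg A)
        ; op-cong = Congruence.compat θ
        }
    ; sat = λ e ρ → Congruence.⊇≈ θ (sat A e ρ)
    }

  natEpi : (A : VAlgebra) (θ : Congruence A) → Hom sig (alg A) (alg (Quot A θ))
  natEpi A θ = record
    { fun      = id
    ; cong     = Congruence.⊇≈ θ
    ; preserve = λ f xs → IsEquivalence.reflexive (Congruence.isEquiv θ)
                            (P.cong (op (alg A) f) (P.sym (map-id xs)))
    }

  GeneratedBy : (A : VAlgebra) {X : Set} → (X → Carrier (alg A)) → Set
  GeneratedBy A {X} a = (x : Carrier (alg A)) →
    Σ[ t ∈ Term sig X ] _≈_ (alg A) (eval (alg A) a t) x

  FinitelyGenerated : VAlgebra → Set
  FinitelyGenerated A = Σ[ n ∈ ℕ ] Σ[ a ∈ (Fin n → Carrier (alg A)) ] GeneratedBy A a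

  OneGenerated : VAlgebra → Set
  OneGenerated A = Σ[ a ∈ Carrier (alg A) ] GeneratedBy A {⊤} (λ _ → a)

  Projective : VAlgebra → Set₁
  Projective A = Σ[ X ∈ Set ] Σ[ i ∈ Hom sig (alg A) (alg (F X)) ]
                 Σ[ r ∈ Hom sig (alg (F X)) (alg A) ]
                 ((x : Carrier (alg A)) → _≈_ (alg A) (fun r (fun i x)) x)

  FGProjective : VAlgebra → Set₁
  FGProjective A = FinitelyGenerated A × Projective A

  Injective : {A B : VAlgebra} → Hom sig (alg A) (alg B) → Set
  Injective {A} {B} e = ∀ x y → _≈_ (alg B) (fun e x) (fun e y) → _≈_ (alg A) x y

  -- exact = isomorphic to a finitely generated subalgebra of a finitely
  -- generated free algebra, i.e. finitely generated and embeddable into some F_V(Fin n)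
  Exact : VAlgebra → Set
  Exact E = FinitelyGenerated E ×
            (Σ[ n ∈ ℕ ] Σ[ e ∈ Hom sig (alg E) (alg (F (Fin n))) ] Injective {E} {F (Fin n)} e)

  ProjectiveCong : {X : Set} → Congruence (F X) → Set₁
  ProjectiveCong {X} θ = Projective (Quot (F X) θ)

  Fz : VAlgebra
  Fz = F ⊤

  record EGenProblem : Set₁ where
    field
      m       : ℕ
      m≥1     : m ≥ 1
      E       : Fin m → VAlgebra
      E-1gen  : (k : Fin m) → OneGenerated (E k)
      E-exact : (k : Fin m) → Exact (E k)
      h       : Hom sig (alg Fz) (Prod sig (λ k → alg (E k)))
      surj    : (k : Fin m) (y : Carrier (alg (E k))) →
                Σ[ x ∈ Carrier (alg Fz) ] _≈_ (alg (E k)) (fun h x k) y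

    Target : Algebra sig
    Target = Prod sig (λ k → alg (E k))

    IsSolution : (Pa : VAlgebra) → Hom sig (alg Fz) (alg Pa) → Set₁
    IsSolution Pa g = FGProjective Pa ×
      (Σ[ f ∈ Hom sig (alg Pa) Target ]
         ((x : Carrier (alg Fz)) → _≈_ Target (fun f (fun g x)) (fun h x)))

  KerIs : {Pa : VAlgebra} → Hom sig (alg Fz) (alg Pa) → Congruence Fz → Set
  KerIs {Pa} g θ = (x y : Carrier (alg Fz)) →
    (Congruence.rel θ x y → _≈_ (alg Pa) (fun g x) (fun g y)) ×
    (_≈_ (alg Pa) (fun g x) (fun g y) → Congruence.rel θ x y)

  InG : EGenProblem → Congruence Fz → Set₁
  InG H θ = Σ[ Pa ∈ VAlgebra ] Σ[ g ∈ Hom sig (alg Fz) (alg Pa) ]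
            (EGenProblem.IsSolution H Pa g × KerIs {Pa} g θ)

  _⊑_ : {Pa Q : VAlgebra} → Hom sig (alg Fz) (alg Pa) → Hom sig (alg Fz) (alg Q) → Set
  _⊑_ {Pa} {Q} g g' = Σ[ f ∈ Hom sig (alg Q) (alg Pa) ]
    ((x : Carrier (alg Fz)) → _≈_ (alg Pa) (fun f (fun g' x)) (fun g x))

-- Every solution g with kernel θ factors through n_θ, because a homomorphism
-- whose kernel contains θ descends to F(z)/θ; so n_θ inherits a solution's
-- witness f ∘ ḡ and is itself a solution as soon as F(z)/θ is projective
-- (it is always 1-generated, by the class of z).  Conversely a solution's
-- target is projective by definition.
module Submission where

open import Defs
open import Data.Product using (_×_; _,_; proj₁; proj₂)
open import Data.Unit using (⊤; tt)
open import Data.Fin using (zero)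
open import Data.Vec using (Vec; []; _∷_; map)
open import Data.Vec.Properties using (map-∘)
open import Function using (_∘_)
open import Function.Bundles using (_⇔_; mk⇔)
open import Relation.Binary.Structures using (IsEquivalence)
open import Relation.Binary.PropositionalEquality as P using (_≡_)

module _ {S : Signature} where
  open Signature S

  module _ {A : Set} (op : (f : Op) → Vec A (arity f) → A) {X Y : Set}
           (σ : X → Term S Y) (ρ : Y → A) where
    mutual
      evalI-subst : (t : Term S X) →
        evalI S op ρ (subst S σ t) ≡ evalI S op (evalI S op ρ ∘ σ) t
      evalI-subst (var x)    = P.refl
      evalI-subst (app f ts) = P.cong (op f) (evalsI-subst ts)

      evalsI-subst : ∀ {n} (ts : Vec (Term S X) n) →
        evalsI S op ρ (evalsI S app σ ts) ≡ evalsI S op (evalI S op ρ ∘ σ) ts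
      evalsI-subst []       = P.refl
      evalsI-subst (t ∷ ts) = P.cong₂ _∷_ (evalI-subst t) (evalsI-subst ts)

  mutual
    evalI-var : {X : Set} (t : Term S X) → evalI S app var t ≡ t
    evalI-var (var x)    = P.refl
    evalI-var (app f ts) = P.cong (app f) (evalsI-var ts)

    evalsI-var : ∀ {X n} (ts : Vec (Term S X) n) → evalsI S app var ts ≡ ts
    evalsI-var []       = P.refl
    evalsI-var (t ∷ ts) = P.cong₂ _∷_ (evalI-var t) (evalsI-var ts)

  _∘-hom_ : {A B C : Algebra S} → Hom S B C → Hom S A B → Hom S A C
  _∘-hom_ {A} {B} {C} k g = record
    { fun      = fun k ∘ fun g
    ; cong     = cong k ∘ cong g
    ; preserve = λ f xs → trans (cong k (preserve g f xs))
        (trans (preserve k f (map (fun g) xs))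
               (reflexive (P.cong (op C f) (P.sym (map-∘ (fun k) (fun g) xs)))))
    }
    where open IsEquivalence (isEquiv C)

module _ (V : Variety) where
  private
    S = Variety.sig V

  F-generatedBy-var : (X : Set) → GeneratedBy V (F V X) var
  F-generatedBy-var X t = t , IsEquivalence.reflexive (isEquiv (alg (F V X))) (evalI-var t)

  Quot-generatedBy : {A : VAlgebra V} (θ : Congruence V A) {X : Set}
    {a : X → Carrier (alg A)} → GeneratedBy V A a → GeneratedBy V (Quot V A θ) a
  Quot-generatedBy θ gen x = proj₁ (gen x) , Congruence.⊇≈ θ (proj₂ (gen x))

  oneGenerated⇒finitelyGenerated : {A : VAlgebra V} →
    OneGenerated V A → FinitelyGenerated V A
  oneGenerated⇒finitelyGenerated {A} (a , gen) = 1 , (λ _ → a) , λ x →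
    let t , evalt≈x = gen x in
    subst S (λ _ → var zero) t ,
    IsEquivalence.trans (isEquiv (alg A))
      (IsEquivalence.reflexive (isEquiv (alg A))
        (evalI-subst (op (alg A)) (λ _ → var zero) (λ _ → a) t))
      evalt≈x

  Fz/θ-finitelyGenerated : (θ : Congruence V (Fz V)) →
    FinitelyGenerated V (Quot V (Fz V) θ)
  Fz/θ-finitelyGenerated θ =
    oneGenerated⇒finitelyGenerated {Quot V (Fz V) θ}
      (var tt , Quot-generatedBy θ (F-generatedBy-var ⊤))

  Quot-lift : {A : VAlgebra V} {B : Algebra S} (θ : Congruence V A) (g : Hom S (alg A) B) →
    (∀ x y → Congruence.rel θ x y → _≈_ B (fun g x) (fun g y)) →
    Hom S (alg (Quot V A θ)) B
  Quot-lift θ g θ⊆ker = record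
    { fun      = fun g
    ; cong     = λ {x} {y} → θ⊆ker x y
    ; preserve = preserve g
    }

  kernel⊑natEpi : {Pa : VAlgebra V} {θ : Congruence V (Fz V)}
    (g : Hom S (alg (Fz V)) (alg Pa)) →
    KerIs V {Pa} g θ → _⊑_ V {Pa} {Quot V (Fz V) θ} g (natEpi V (Fz V) θ)
  kernel⊑natEpi {Pa} {θ} g ker =
    Quot-lift θ g (λ x y → proj₁ (ker x y)) , λ _ → IsEquivalence.refl (isEquiv (alg Pa))

  IsSolution-⊑ : (H : EGenProblem V) {Pa Q : VAlgebra V}
    (g : Hom S (alg (Fz V)) (alg Pa)) (g′ : Hom S (alg (Fz V)) (alg Q)) →
    EGenProblem.IsSolution H Pa g → _⊑_ V {Pa} {Q} g g′ → FGProjective V Q →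
    EGenProblem.IsSolution H Q g′
  IsSolution-⊑ H _ _ (_ , f , fg≈h) (k , kg′≈g) Q-fgp =
    Q-fgp , f ∘-hom k , λ x → trans (cong f (kg′≈g x)) (fg≈h x)
    where open IsEquivalence (isEquiv (EGenProblem.Target H))

proposition4p17 : (V : Variety) (H : EGenProblem V) (θ : Congruence V (Fz V)) →
    InG V H θ →
    (EGenProblem.IsSolution H (Quot V (Fz V) θ) (natEpi V (Fz V) θ) ⇔ ProjectiveCong V θ)
    × (EGenProblem.IsSolution H (Quot V (Fz V) θ) (natEpi V (Fz V) θ) →
       (Pa : VAlgebra V) (g : Hom (Variety.sig V) (alg (Fz V)) (alg Pa)) →
       EGenProblem.IsSolution H Pa g → KerIs V {Pa} g θ →
       _⊑_ V {Pa} {Quot V (Fz V) θ} g (natEpi V (Fz V) θ))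
proposition4p17 V H θ (P₀ , g₀ , sol₀ , ker₀) =
  mk⇔ (proj₂ ∘ proj₁) natEpi-solution ,
  λ _ Pa g _ ker → kernel⊑natEpi V {Pa} {θ} g ker
  where
  Fz/θ : VAlgebra V
  Fz/θ = Quot V (Fz V) θ

  n-θ : Hom (Variety.sig V) (alg (Fz V)) (alg Fz/θ)
  n-θ = natEpi V (Fz V) θ

  natEpi-solution : ProjectiveCong V θ → EGenProblem.IsSolution H Fz/θ n-θ
  natEpi-solution projective =
    IsSolution-⊑ V H {P₀} {Fz/θ} g₀ n-θ sol₀ (kernel⊑natEpi V {P₀} {θ} g₀ ker₀)
      (Fz/θ-finitelyGenerated V θ , projective)
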